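{- Let $\mathcal{M}$ be an $n$-maniplex with a weight function $\omega\colon E(\mathcal{M})\to\mathbb{Z}_k$ and an $\ell$-colouring $\mathcal{C}$ of its facets. Let $x\in\mathbb{Z}_2^\ell$ and let $F_x$ be the corresponding facet of $2^{(\mathcal{M},\mathcal{C})}$. Then the cross-cover $(F_x)^{\omega_\mathcal{C}}$ (with $\omega_\mathcal{C}$ restricted to the edges of $F_x$) is isomorphic to $\mathcal{M}^\omega$.
   Context: An $n$-maniplex is a connected $n$-valent simple graph with a proper edge-colouring by $\{0,\dots,n-1\}$ such that whenever $|i-j|>1$ the edges of colours $i,j$ form a disjoint union of $4$-cycles. Vertices are flags; $u^i$ is the $i$-neighbour of $u$. Facets are the connected components after deleting the edges of colour $n-1$. An $\ell$-colouring is a surjection $\mathcal{C}$ from facets to $\{1,\dots,\ell\}$; a flag's colour is its facet's colour. The colour-coded extension $2^{(\mathcal{M},\mathcal{C})}$ is the $(n+1)$-maniplex with flag set $\mathcal{F}\times\mathbb{Z}_2^\ell$ ($\mathcal{F}$ the flags of $\mathcal{M}$), with $(u,x)^i=(u^i,x)$ for $i<n$ and $(u,x)^n=(u,x^j)$ where $j$ is the colour of $u$ and $x^j$ differs from $x$ only in coordinate $j$. For $x\in\mathbb{Z}_2^\ell$, $F_x$ is the facet of $2^{(\mathcal{M},\mathcal{C})}$ induced by the flags with second coordinate $x$ (edges of colours $<n$). The parity $\sigma(x)$ is $(-1)^b$ with $b$ the number of coordinates of $x$ equal to $1$. The extended weight $\omega_\mathcal{C}$ assigns to the $i$-edge joining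 $(u,x)$ and $(u^i,x)$ ($i<n$) the value $\sigma(x)\omega(uu^i)$, and $0$ to every $n$-edge. For a graph $\Gamma$ with weight $\omega\colon E(\Gamma)\to\mathbb{Z}_k$, the cross-cover $\Gamma^\omega$ has vertex set $V(\Gamma)\times\mathbb{Z}_k$ with $(u,i)$ adjacent to $(v,\omega(e)-i)$ for each edge $e=uv$ and $i\in\mathbb{Z}_k$. -}

module Defs where

open import Level using (Level; suc; zero)
open import Data.Nat as ℕ using (ℕ; NonZero; _∸_)
open import Data.Nat.DivMod using (_mod_)
open import Data.Fin as Fin using (Fin; toℕ; fromℕ; inject₁)
open import Data.Bool using (Bool; true; false; not)
open import Data.Vec using (Vec; updateAt)
open import Data.Unit using (⊤; tt)
open import Data.Sum using (_⊎_; inj₁; inj₂)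
open import Data.Product using (Σ; ∃; _×_; _,_; proj₁; proj₂)
open import Relation.Nullary using (¬_)
open import Relation.Binary.PropositionalEquality using (_≡_; _≢_; refl; cong; subst)
open import Relation.Binary.Construct.Closure.ReflexiveTransitive using (Star)
open import Function.Bundles using (_↔_; _⇔_; Inverse)

ℤ_ : (k : ℕ) → Set
ℤ_ k = Fin k

module _ {k : ℕ} .{{_ : NonZero k}} where

  _+ₖ_ : ℤ_ k → ℤ_ k → ℤ_ k
  a +ₖ b = (toℕ a ℕ.+ toℕ b) mod k

  -ₖ_ : ℤ_ k → ℤ_ k
  -ₖ a = (k ∸ toℕ a) mod k

  _-ₖ_ : ℤ_ k → ℤ_ k → ℤ_ k
  a -ₖ b = a +ₖ (-ₖ b)

  0ₖ : ℤ_ k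
  0ₖ = 0 mod k

  signPow : ℕ → ℤ_ k → ℤ_ k
  signPow ℕ.zero    a = a
  signPow (ℕ.suc b) a = -ₖ (signPow b a)

-- Maniplexes.  Flags form a type F; u^i is  nb i u.
-- The i-edges are exactly the pairs {u, nb i u}.

record Maniplex (n : ℕ) : Set₁ where
  field
    F        : Set
    nb       : Fin n → F → F
    -- each flag has exactly one i-edge (proper edge colouring, n-valent)
    invol    : ∀ i u → nb i (nb i u) ≡ u
    noLoop   : ∀ i u → nb i u ≢ u
    noMulti  : ∀ i j u → i ≢ j → nb i u ≢ nb j u
    -- |i - j| > 1 : the i,j-edges form disjoint 4-cycles
    fourCyc  : ∀ i j → ℕ.suc (toℕ i) ℕ.< toℕ j → ∀ u → nb i (nb j u) ≡ nb j (nb i u)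
    connected : ∀ u v → Star (λ a b → ∃ λ i → nb i a ≡ b) u v

-- A weight  ω : E(M) → ℤ_k : the edge {u, u^i} gets  w i u ; well defined on edges.
record Weight {n : ℕ} (M : Maniplex n) (k : ℕ) : Set where
  open Maniplex M
  field
    w    : Fin n → F → ℤ_ k
    wsym : ∀ i u → w i (nb i u) ≡ w i u

-- Facets are the components after deleting the edges of colour m = n-1; a
-- function on facets is a function on flags constant along edges of colour ≠ m.
record Colouring {m : ℕ} (M : Maniplex (ℕ.suc m)) (ℓ : ℕ) : Set where
  open Maniplex M
  field
    col      : F → Fin ℓ
    facetwise : ∀ i u → i ≢ fromℕ m → col (nb i u) ≡ col u
    surj     : ∀ c → ∃ λ u → col u ≡ c

record Graph : Set₁ where
  field
    V   : Set
    Adj : V → V → Set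

_≅G_ : Graph → Graph → Set
G ≅G H = Σ (Graph.V G ↔ Graph.V H) λ φ →
  ∀ a b → Graph.Adj G a b ⇔ Graph.Adj H (Inverse.to φ a) (Inverse.to φ b)

-- A graph whose edges are given by colours: edge {v, nb i v} of colour i with
-- weight  w i v  (assumed well defined on edges).
record ColWGraph (n k : ℕ) : Set₁ where
  field
    V  : Set
    nb : Fin n → V → V
    w  : Fin n → V → ℤ_ k

crossCover : ∀ {n k} .{{_ : NonZero k}} → ColWGraph n k → Graph
crossCover {n} {k} Γ = record
  { V   = V × ℤ_ k
  ; Adj = λ { (u , a) (v , b) → ∃ λ (i : Fin n) →
              (nb i u ≡ v × b ≡ w i u -ₖ a) ⊎ (nb i v ≡ u × b ≡ w i v -ₖ a) } }
  where open ColWGraph Γ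

maniplexGraph : ∀ {n k} (M : Maniplex n) → Weight M k → ColWGraph n k
maniplexGraph M ω = record { V = Maniplex.F M ; nb = Maniplex.nb M ; w = Weight.w ω }

-- colours of the (n+1)-maniplex: old colour i < n, or the new colour n
classify : ∀ {n} → Fin (ℕ.suc n) → Fin n ⊎ ⊤
classify {ℕ.zero}  Fin.zero    = inj₂ tt
classify {ℕ.suc n} Fin.zero    = inj₁ Fin.zero
classify {ℕ.suc n} (Fin.suc i) with classify i
... | inj₁ j = inj₁ (Fin.suc j)
... | inj₂ t = inj₂ t

classify-inject₁ : ∀ {n} (i : Fin n) → classify (inject₁ i) ≡ inj₁ i
classify-inject₁ {ℕ.suc n} Fin.zero = refl
classify-inject₁ {ℕ.suc n} (Fin.suc i) rewrite classify-inject₁ i = refl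

flipAt : ∀ {ℓ} → Vec Bool ℓ → Fin ℓ → Vec Bool ℓ
flipAt x j = updateAt x j not

ones : ∀ {ℓ} → Vec Bool ℓ → ℕ
ones Data.Vec.[] = 0
ones (true  Data.Vec.∷ x) = ℕ.suc (ones x)
ones (false Data.Vec.∷ x) = ones x

module Extension {m k ℓ : ℕ} .{{_ : NonZero k}} (M : Maniplex (ℕ.suc m))
                 (ω : Weight M k) (C : Colouring M ℓ) where
  open Maniplex M
  open Weight ω
  open Colouring C

  ExtFlag : Set
  ExtFlag = F × Vec Bool ℓ

  extNb' : Fin (ℕ.suc m) ⊎ ⊤ → ExtFlag → ExtFlag
  extNb' (inj₁ i) (u , x) = (nb i u , x)
  extNb' (inj₂ _) (u , x) = (u , flipAt x (col u))

  extNb : Fin (ℕ.suc (ℕ.suc m)) → ExtFlag → ExtFlag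
  extNb i = extNb' (classify i)

  σ· : Vec Bool ℓ → ℤ_ k → ℤ_ k
  σ· x a = signPow (ones x) a

  extW' : Fin (ℕ.suc m) ⊎ ⊤ → ExtFlag → ℤ_ k
  extW' (inj₁ i) (u , x) = σ· x (w i u)
  extW' (inj₂ _) _       = 0ₖ

  extW : Fin (ℕ.suc (ℕ.suc m)) → ExtFlag → ℤ_ k
  extW i = extW' (classify i)

  FacetFlag : Vec Bool ℓ → Set
  FacetFlag x = Σ ExtFlag λ p → proj₂ p ≡ x

  facetNb : ∀ x → Fin (ℕ.suc m) → FacetFlag x → FacetFlag x
  facetNb x i (p , e) =
    extNb (inject₁ i) p ,
    subst (λ c → proj₂ (extNb' c p) ≡ _) (Relation.Binary.PropositionalEquality.sym (classify-inject₁ i)) e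

  facet : Vec Bool ℓ → ColWGraph (ℕ.suc m) k
  facet x = record
    { V  = FacetFlag x
    ; nb = facetNb x
    ; w  = λ i v → extW (inject₁ i) (proj₁ v) }

-- A facet F_x of 2^(M,C) consists of the flags (u , x), joined exactly as in M, and
-- its i-edge at (u , x) has weight σ(x)·ω(u u^i); so F_x is M reweighted by σ(x).
-- Multiplying all weights by σ(x) = ±1 does not change the cross-cover up to
-- isomorphism: (u , a) ↦ (u , σ(x)·a) is one, since  b = σ w − a  iff  σ b = w − σ a.
module Submission where

open import Defs
open import Data.Nat using (ℕ; suc; zero; NonZero; _+_; _∸_; _%_)
open import Data.Nat.Properties using (+-comm; +-assoc; +-identityʳ; m+[n∸m]≡n; <⇒≤)
open import Data.Nat.DivMod using (_mod_; m%n<n; m%n%n≡m%n; %-distribˡ-+; m<n⇒m%n≡m; [m+n]%n≡m%n)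
open import Data.Fin using (toℕ)
open import Data.Fin.Properties using (toℕ-fromℕ<; fromℕ<-cong; toℕ-injective; toℕ<n)
open import Data.Bool using (Bool)
open import Data.Vec using (Vec)
open import Data.Product using (_×_; _,_; proj₁; map₂)
open import Data.Product.Function.Dependent.Propositional using (congˡ)
open import Data.Product.Function.NonDependent.Propositional using (_×-⇔_)
open import Data.Sum.Function.Propositional using (_⊎-⇔_)
open import Level using (0ℓ)
open import Algebra.Bundles using (AbelianGroup)
open import Algebra.Structures using (IsAbelianGroup)
open import Algebra.Consequences.Propositional using (comm∧idʳ⇒id; comm∧invʳ⇒inv)
import Algebra.Properties.AbelianGroup as AbelianGroupProperties
open import Function.Bundles using (_↔_; _⇔_; Inverse; Injection; mk↔ₛ′; mk⇔)
open import Function.Construct.Identity using (⇔-id)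
open import Function.Construct.Composition using (_↔-∘_; _⇔-∘_)
open import Function.Properties.Inverse using (↔⇒↣)
open import Function.Related.Propositional using (equivalence)
open import Relation.Binary.PropositionalEquality
open ≡-Reasoning

module _ {k : ℕ} .{{_ : NonZero k}} where

  toℕ-mod : ∀ n → toℕ (n mod k) ≡ n % k
  toℕ-mod n = toℕ-fromℕ< (m%n<n n k)

  mod-cong : ∀ {m n} → m % k ≡ n % k → m mod k ≡ n mod k
  mod-cong {m} {n} eq = fromℕ<-cong _ _ eq (m%n<n m k) (m%n<n n k)

  [m%k+n]%k≡[m+n]%k : ∀ m n → (m % k + n) % k ≡ (m + n) % k
  [m%k+n]%k≡[m+n]%k m n = begin
    (m % k + n) % k         ≡⟨ %-distribˡ-+ (m % k) n k ⟩
    (m % k % k + n % k) % k ≡⟨ cong (λ r → (r + n % k) % k) (m%n%n≡m%n m k) ⟩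
    (m % k + n % k) % k     ≡⟨ %-distribˡ-+ m n k ⟨
    (m + n) % k             ∎

  [m+n%k]%k≡[m+n]%k : ∀ m n → (m + n % k) % k ≡ (m + n) % k
  [m+n%k]%k≡[m+n]%k m n = begin
    (m + n % k) % k ≡⟨ cong (_% k) (+-comm m (n % k)) ⟩
    (n % k + m) % k ≡⟨ [m%k+n]%k≡[m+n]%k n m ⟩
    (n + m) % k     ≡⟨ cong (_% k) (+-comm n m) ⟩
    (m + n) % k     ∎

  +ₖ-comm : ∀ (a b : ℤ_ k) → a +ₖ b ≡ b +ₖ a
  +ₖ-comm a b = cong (_mod k) (+-comm (toℕ a) (toℕ b))

  +ₖ-assoc : ∀ (a b c : ℤ_ k) → (a +ₖ b) +ₖ c ≡ a +ₖ (b +ₖ c)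
  +ₖ-assoc a b c = mod-cong (begin
    (toℕ (a +ₖ b) + toℕ c) % k            ≡⟨ cong (λ r → (r + toℕ c) % k) (toℕ-mod _) ⟩
    ((toℕ a + toℕ b) % k + toℕ c) % k     ≡⟨ [m%k+n]%k≡[m+n]%k (toℕ a + toℕ b) (toℕ c) ⟩
    (toℕ a + toℕ b + toℕ c) % k           ≡⟨ cong (_% k) (+-assoc (toℕ a) (toℕ b) (toℕ c)) ⟩
    (toℕ a + (toℕ b + toℕ c)) % k         ≡⟨ [m+n%k]%k≡[m+n]%k (toℕ a) (toℕ b + toℕ c) ⟨
    (toℕ a + (toℕ b + toℕ c) % k) % k     ≡⟨ cong (λ r → (toℕ a + r) % k) (toℕ-mod _) ⟨
    (toℕ a + toℕ (b +ₖ c)) % k            ∎)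

  +ₖ-identityʳ : ∀ (a : ℤ_ k) → a +ₖ 0ₖ ≡ a
  +ₖ-identityʳ a = toℕ-injective (begin
    toℕ (a +ₖ 0ₖ)              ≡⟨ toℕ-mod _ ⟩
    (toℕ a + toℕ (0ₖ {k})) % k ≡⟨ cong (λ r → (toℕ a + r) % k) (toℕ-mod 0) ⟩
    (toℕ a + 0 % k) % k        ≡⟨ [m+n%k]%k≡[m+n]%k (toℕ a) 0 ⟩
    (toℕ a + 0) % k            ≡⟨ cong (_% k) (+-identityʳ (toℕ a)) ⟩
    toℕ a % k                  ≡⟨ m<n⇒m%n≡m (toℕ<n a) ⟩
    toℕ a                      ∎)

  +ₖ-inverseʳ : ∀ (a : ℤ_ k) → a +ₖ (-ₖ a) ≡ 0ₖ
  +ₖ-inverseʳ a = mod-cong (begin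
    (toℕ a + toℕ (-ₖ a)) % k        ≡⟨ cong (λ r → (toℕ a + r) % k) (toℕ-mod _) ⟩
    (toℕ a + (k ∸ toℕ a) % k) % k   ≡⟨ [m+n%k]%k≡[m+n]%k (toℕ a) (k ∸ toℕ a) ⟩
    (toℕ a + (k ∸ toℕ a)) % k       ≡⟨ cong (_% k) (m+[n∸m]≡n (<⇒≤ (toℕ<n a))) ⟩
    k % k                           ≡⟨ [m+n]%n≡m%n 0 k ⟩
    0 % k                           ∎)

  +ₖ-isAbelianGroup : IsAbelianGroup _≡_ _+ₖ_ 0ₖ (-ₖ_)
  +ₖ-isAbelianGroup = record
    { isGroup = record
      { isMonoid = record
        { isSemigroup = record
          { isMagma = record { isEquivalence = isEquivalence ; ∙-cong = cong₂ _+ₖ_ }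
          ; assoc   = +ₖ-assoc
          }
        ; identity = comm∧idʳ⇒id +ₖ-comm +ₖ-identityʳ
        }
      ; inverse = comm∧invʳ⇒inv +ₖ-comm +ₖ-inverseʳ
      ; ⁻¹-cong = cong (-ₖ_)
      }
    ; comm = +ₖ-comm
    }

  ℤₖ-abelianGroup : AbelianGroup 0ℓ 0ℓ
  ℤₖ-abelianGroup = record { isAbelianGroup = +ₖ-isAbelianGroup }

  open AbelianGroupProperties ℤₖ-abelianGroup using (⁻¹-involutive; ⁻¹-∙-comm)

  -ₖ-distrib-minus : ∀ (p q : ℤ_ k) → -ₖ (p -ₖ q) ≡ (-ₖ p) -ₖ (-ₖ q)
  -ₖ-distrib-minus p q = sym (⁻¹-∙-comm p (-ₖ q))

  signPow-neg : ∀ b (a : ℤ_ k) → signPow b (-ₖ a) ≡ -ₖ signPow b a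
  signPow-neg zero    a = refl
  signPow-neg (suc b) a = cong (-ₖ_) (signPow-neg b a)

  signPow-involutive : ∀ b (a : ℤ_ k) → signPow b (signPow b a) ≡ a
  signPow-involutive zero    a = refl
  signPow-involutive (suc b) a = begin
    -ₖ signPow b (-ₖ signPow b a)    ≡⟨ cong (-ₖ_) (signPow-neg b (signPow b a)) ⟩
    -ₖ (-ₖ signPow b (signPow b a))  ≡⟨ ⁻¹-involutive _ ⟩
    signPow b (signPow b a)          ≡⟨ signPow-involutive b a ⟩
    a                                ∎

  signPow-distrib-minus : ∀ b (p q : ℤ_ k) → signPow b (p -ₖ q) ≡ signPow b p -ₖ signPow b q
  signPow-distrib-minus zero    p q = refl
  signPow-distrib-minus (suc b) p q = begin
    -ₖ signPow b (p -ₖ q)                   ≡⟨ cong (-ₖ_) (signPow-distrib-minus b p q) ⟩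
    -ₖ (signPow b p -ₖ signPow b q)         ≡⟨ -ₖ-distrib-minus (signPow b p) (signPow b q) ⟩
    (-ₖ signPow b p) -ₖ (-ₖ signPow b q)    ∎

≅G-trans : ∀ {G H K} → G ≅G H → H ≅G K → G ≅G K
≅G-trans (φ , φ-adj) (ψ , ψ-adj) =
  ψ ↔-∘ φ , λ a b → ψ-adj (Inverse.to φ a) (Inverse.to φ b) ⇔-∘ φ-adj a b

≡-target-⇔ : ∀ {A : Set} {b x y : A} → x ≡ y → (b ≡ x) ⇔ (b ≡ y)
≡-target-⇔ x≡y = mk⇔ (λ e → trans e x≡y) (λ e → trans e (sym x≡y))

record _≅W_ {n k : ℕ} (Γ Δ : ColWGraph n k) : Set where
  field
    vertex↔ : ColWGraph.V Γ ↔ ColWGraph.V Δ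
    nb-homo : ∀ i v → Inverse.to vertex↔ (ColWGraph.nb Γ i v) ≡ ColWGraph.nb Δ i (Inverse.to vertex↔ v)
    w-homo  : ∀ i v → ColWGraph.w Γ i v ≡ ColWGraph.w Δ i (Inverse.to vertex↔ v)

module _ {n k : ℕ} .{{_ : NonZero k}} where

  crossCover-resp-≅W : {Γ Δ : ColWGraph n k} → Γ ≅W Δ → crossCover Γ ≅G crossCover Δ
  crossCover-resp-≅W {Γ} {Δ} iso = vertex×ℤₖ↔ , adj⇔
    where
    open _≅W_ iso
    module Γ = ColWGraph Γ
    module Δ = ColWGraph Δ
    φ : Γ.V → Δ.V
    φ = Inverse.to vertex↔

    vertex×ℤₖ↔ : (Γ.V × ℤ_ k) ↔ (Δ.V × ℤ_ k)
    vertex×ℤₖ↔ = mk↔ₛ′ (λ (v , a) → φ v , a) (λ (v , a) → Inverse.from vertex↔ v , a)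
      (λ (v , a) → cong (_, a) (Inverse.strictlyInverseˡ vertex↔ v))
      (λ (v , a) → cong (_, a) (Inverse.strictlyInverseʳ vertex↔ v))

    nb-⇔ : ∀ i u v → (Γ.nb i u ≡ v) ⇔ (Δ.nb i (φ u) ≡ φ v)
    nb-⇔ i u v = mk⇔ (λ e → trans (sym (nb-homo i u)) (cong φ e))
                     (λ e → Injection.injective (↔⇒↣ vertex↔) (trans (nb-homo i u) e))

    adj⇔ : ∀ p q → Graph.Adj (crossCover Γ) p q
                 ⇔ Graph.Adj (crossCover Δ) (Inverse.to vertex×ℤₖ↔ p) (Inverse.to vertex×ℤₖ↔ q)
    adj⇔ (u , a) (v , b) = congˡ {k = equivalence} λ {i} →
      (nb-⇔ i u v ×-⇔ ≡-target-⇔ (cong (_-ₖ a) (w-homo i u)))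
        ⊎-⇔ (nb-⇔ i v u ×-⇔ ≡-target-⇔ (cong (_-ₖ a) (w-homo i v)))

  reweight : (ℤ_ k → ℤ_ k) → ColWGraph n k → ColWGraph n k
  reweight σ Γ = record Γ { w = λ i v → σ (ColWGraph.w Γ i v) }

  crossCover-reweight : {σ : ℤ_ k → ℤ_ k} →
    (∀ a → σ (σ a) ≡ a) → (∀ p q → σ (p -ₖ q) ≡ σ p -ₖ σ q) →
    (Γ : ColWGraph n k) → crossCover (reweight σ Γ) ≅G crossCover Γ
  crossCover-reweight {σ} σ-involutive σ-distrib-minus Γ = vertex×ℤₖ↔ , adj⇔
    where
    open ColWGraph Γ

    vertex×ℤₖ↔ : (V × ℤ_ k) ↔ (V × ℤ_ k)
    vertex×ℤₖ↔ = mk↔ₛ′ (map₂ σ) (map₂ σ)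
      (λ (v , a) → cong (v ,_) (σ-involutive a)) (λ (v , a) → cong (v ,_) (σ-involutive a))

    σ-transpose : ∀ {b c} → (b ≡ σ c) ⇔ (σ b ≡ c)
    σ-transpose = mk⇔ (λ e → trans (cong σ e) (σ-involutive _))
                      (λ e → trans (sym (σ-involutive _)) (cong σ e))

    twist : ∀ c a b → (b ≡ σ c -ₖ a) ⇔ (σ b ≡ c -ₖ σ a)
    twist c a b = σ-transpose ⇔-∘ ≡-target-⇔ (sym (begin
      σ (c -ₖ σ a)     ≡⟨ σ-distrib-minus c (σ a) ⟩
      σ c -ₖ σ (σ a)   ≡⟨ cong (λ r → σ c -ₖ r) (σ-involutive a) ⟩
      σ c -ₖ a         ∎))

    adj⇔ : ∀ p q → Graph.Adj (crossCover (reweight σ Γ)) p q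
                 ⇔ Graph.Adj (crossCover Γ) (Inverse.to vertex×ℤₖ↔ p) (Inverse.to vertex×ℤₖ↔ q)
    adj⇔ (u , a) (v , b) = congˡ {k = equivalence} λ {i} →
      (⇔-id _ ×-⇔ twist (w i u) a b) ⊎-⇔ (⇔-id _ ×-⇔ twist (w i v) a b)

module _ {m k ℓ : ℕ} .{{_ : NonZero k}} (M : Maniplex (suc m)) (ω : Weight M k) (C : Colouring M ℓ) where
  open Extension M ω C

  facet≅reweighted : ∀ x → facet x ≅W reweight (signPow (ones x)) (maniplexGraph M ω)
  facet≅reweighted x = record
    { vertex↔ = mk↔ₛ′ (λ v → proj₁ (proj₁ v)) (λ u → (u , x) , refl)
                      (λ _ → refl) (λ { ((_ , _) , refl) → refl })
    ; nb-homo = λ i ((u , y) , _) → cong (λ c → proj₁ (extNb' c (u , y))) (classify-inject₁ i)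
    ; w-homo  = λ { i ((u , _) , refl) → cong (λ c → extW' c (u , x)) (classify-inject₁ i) }
    }

lemma5p2 : ∀ {m k ℓ : ℕ} .{{_ : NonZero k}} (M : Maniplex (suc m)) (ω : Weight M k) (C : Colouring M ℓ) (x : Vec Bool ℓ) →
    crossCover (Extension.facet M ω C x) ≅G crossCover (maniplexGraph M ω)
lemma5p2 M ω C x =
  ≅G-trans {K = crossCover (maniplexGraph M ω)}
           (crossCover-resp-≅W (facet≅reweighted M ω C x))
           (crossCover-reweight (signPow-involutive (ones x)) (signPow-distrib-minus (ones x))
                                (maniplexGraph M ω))
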